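{- Let $S$ be a semiring, $(X,a)$ an $\mathcal S$-algebra and $\mathcal A\subseteq\mathcal SX$. Then \[ \mathcal Pa\bigl(\mathrm{conv}_{\mu^{\mathcal S}_X}(\mathcal A)\bigr)=\mathrm{conv}_a\bigl(\mathcal Pa(\mathcal A)\bigr), \] where $\mathcal Pa$ denotes direct image along $a$.
   Context: $\mathcal S$ is the monad on Set with $\mathcal SX$ the finitely supported functions $X\to S$, $\mathcal S(f)(\phi)(y)=\sum_{x\in f^{ -1}\{y\}}\phi(x)$, unit $x\mapsto\Delta_x$ (Dirac function), multiplication $\mu^{\mathcal S}_X(\Psi)(x)=\sum_{\phi\in\mathrm{supp}\Psi}\Psi(\phi)\phi(x)$. An $\mathcal S$-algebra is $(X,a\colon\mathcal SX\to X)$ with $a\circ\eta^{\mathcal S}_X=\mathrm{id}$ and $a\circ\mu^{\mathcal S}_X=a\circ\mathcal S(a)$. For an $\mathcal S$-algebra $(Y,b)$ and $B\subseteq Y$, $\mathrm{conv}_b(B)=\{b(\phi)\mid\phi\in\mathcal SY,\ \mathrm{supp}\,\phi\subseteq B,\ \sum_{y}\phi(y)=1\}$. -}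

module Defs where

open import Level using (Level; _⊔_; suc)
open import Algebra.Bundles using (Semiring)
open import Data.List using (List; []; _∷_; map; concatMap; foldr)
open import Data.List.Relation.Unary.All using (All)
open import Data.Product using (_×_; _,_; proj₁; proj₂; Σ; ∃)
open import Relation.Binary.PropositionalEquality using (_≡_)

-- Throughout, 𝒮Z (finitely supported functions Z → S) is represented by
-- formal finite sums: lists of (point , coefficient) pairs, read as
-- φ = Σ s·Δ_z.  Two representatives denote the same finitely supported
-- function iff they are related by 𝒮≈ below (the congruence generated by
-- reordering, merging equal points, dropping zero coefficients and
-- replacing coefficients by ≈-equal ones).

module _ {c ℓ : Level} (S : Semiring c ℓ) where
  open Semiring S

  𝒮 : {z : Level} → Set z → Set (z ⊔ c)
  𝒮 Z = List (Z × Carrier)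

  data 𝒮≈ {z : Level} {Z : Set z} : 𝒮 Z → 𝒮 Z → Set (z ⊔ c ⊔ ℓ) where
    ≈-refl  : ∀ {p} → 𝒮≈ p p
    ≈-sym   : ∀ {p q} → 𝒮≈ p q → 𝒮≈ q p
    ≈-trans : ∀ {p q r} → 𝒮≈ p q → 𝒮≈ q r → 𝒮≈ p r
    ≈-cons  : ∀ {e p q} → 𝒮≈ p q → 𝒮≈ (e ∷ p) (e ∷ q)
    ≈-coef  : ∀ {x s t p} → s ≈ t → 𝒮≈ ((x , s) ∷ p) ((x , t) ∷ p)
    ≈-swap  : ∀ {e f p} → 𝒮≈ (e ∷ f ∷ p) (f ∷ e ∷ p)
    ≈-merge : ∀ {x s t p} → 𝒮≈ ((x , s) ∷ (x , t) ∷ p) ((x , s + t) ∷ p)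
    ≈-zero  : ∀ {x p} → 𝒮≈ ((x , 0#) ∷ p) p

  𝒮map : {y z : Level} {Y : Set y} {Z : Set z} → (Y → Z) → 𝒮 Y → 𝒮 Z
  𝒮map f = map (λ p → (f (proj₁ p) , proj₂ p))

  η : {z : Level} {Z : Set z} → Z → 𝒮 Z
  η x = (x , 1#) ∷ []

  -- multiplication μ(Ψ)(x) = Σ_φ Ψ(φ) φ(x)
  μ : {z : Level} {Z : Set z} → 𝒮 (𝒮 Z) → 𝒮 Z
  μ = concatMap (λ q → map (λ p → (proj₁ p , proj₂ q * proj₂ p)) (proj₁ q))

  total : {z : Level} {Z : Set z} → 𝒮 Z → Carrier
  total = foldr (λ p r → proj₂ p + r) 0#

  -- an 𝒮-algebra (X , a); a must be well defined on 𝒮X, i.e. respect 𝒮≈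
  record 𝒮Algebra (x : Level) : Set (suc x ⊔ c ⊔ ℓ) where
    field
      X       : Set x
      a       : 𝒮 X → X
      a-resp  : ∀ {φ ψ} → 𝒮≈ φ ψ → a φ ≡ a ψ
      a-unit  : ∀ (t : X) → a (η t) ≡ t
      a-mult  : ∀ (Ψ : 𝒮 (𝒮 X)) → a (μ Ψ) ≡ a (𝒮map a Ψ)

  conv : {y p r : Level} {Y : Set y} (_≈Y_ : Y → Y → Set r)
         (b : 𝒮 Y → Y) (B : Y → Set p) → Y → Set (y ⊔ c ⊔ ℓ ⊔ p ⊔ r)
  conv {Y = Y} _≈Y_ b B t =
    Σ (𝒮 Y) λ φ → All (λ e → B (proj₁ e)) φ × (total φ ≈ 1#) × (b φ ≈Y t)

𝒫 : {y z p : Level} {Y : Set y} {Z : Set z} → (Y → Z) → (Y → Set p) → Z → Set (y ⊔ z ⊔ p)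
𝒫 {Y = Y} f B t = Σ Y λ u → B u × (f u ≡ t)

{-# OPTIONS --safe #-}
module Submission where

open import Defs
open import Level using (Level)
open import Algebra.Bundles using (Semiring)
open import Relation.Binary.PropositionalEquality using (_≡_; refl; trans; sym; cong)
open import Function.Bundles using (_⇔_; mk⇔)
open import Data.List using ([]; _∷_)
open import Data.List.Relation.Unary.All as All using (All; []; _∷_)
open import Data.List.Relation.Unary.All.Properties using (map⁺)
open import Data.Product using (_,_; proj₁; proj₂; Σ; _×_)

-- A formal sum Ψ over 𝒮X with supp Ψ ⊆ 𝒜 is pushed along a to 𝒮a(Ψ), whose
-- support lies in 𝒫a(𝒜) and whose total weight is unchanged; conversely every
-- formal sum supported in 𝒫a(𝒜) lifts to such a Ψ.  The algebra law
-- a ∘ μ = a ∘ 𝒮a then identifies a(μΨ) with a(𝒮a Ψ), matching the two sides.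

module _ {c ℓ : Level} (S : Semiring c ℓ) where
  open Semiring S using (_+_; reflexive) renaming (trans to ≈ˢ-trans)

  module _ {y z : Level} {Y : Set y} {Z : Set z} (f : Y → Z) where

    total-𝒮map : (Ψ : 𝒮 S Y) → total S (𝒮map S f Ψ) ≡ total S Ψ
    total-𝒮map []      = refl
    total-𝒮map (e ∷ Ψ) = cong (proj₂ e +_) (total-𝒮map Ψ)

    module _ {p : Level} {B : Y → Set p} where

      supp-𝒮map⁺ : (Ψ : 𝒮 S Y) → All (λ e → B (proj₁ e)) Ψ →
                   All (λ e → 𝒫 f B (proj₁ e)) (𝒮map S f Ψ)
      supp-𝒮map⁺ Ψ hΨ = map⁺ (All.map (λ {e} h → proj₁ e , h , refl) hΨ)

      supp-𝒫-lift : (φ : 𝒮 S Z) → All (λ e → 𝒫 f B (proj₁ e)) φ →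
                    Σ (𝒮 S Y) λ Ψ → All (λ e → B (proj₁ e)) Ψ × (𝒮map S f Ψ ≡ φ)
      supp-𝒫-lift []             []                  = [] , [] , refl
      supp-𝒫-lift ((_ , s) ∷ φ) ((u , h , refl) ∷ hs) with supp-𝒫-lift φ hs
      ... | Ψ , hΨ , refl = (u , s) ∷ Ψ , h ∷ hΨ , refl

  module _ {x p : Level} (Alg : 𝒮Algebra S x) {A : 𝒮 S (𝒮Algebra.X Alg) → Set p} where
    open 𝒮Algebra Alg

    image-conv-μ⊆conv-image : ∀ {t} →
      𝒫 a (conv S (𝒮≈ S) (μ S) A) t → conv S _≡_ a (𝒫 a A) t
    image-conv-μ⊆conv-image (_ , (Ψ , hΨ , total≈1 , μΨ≈Φ) , aΦ≡t) =
      𝒮map S a Ψ ,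
      supp-𝒮map⁺ a Ψ hΨ ,
      ≈ˢ-trans (reflexive (total-𝒮map a Ψ)) total≈1 ,
      trans (sym (a-mult Ψ)) (trans (a-resp μΨ≈Φ) aΦ≡t)

    conv-image⊆image-conv-μ : ∀ {t} →
      conv S _≡_ a (𝒫 a A) t → 𝒫 a (conv S (𝒮≈ S) (μ S) A) t
    conv-image⊆image-conv-μ (φ , hφ , total≈1 , aφ≡t) with supp-𝒫-lift a φ hφ
    ... | Ψ , hΨ , refl =
      μ S Ψ ,
      (Ψ , hΨ , ≈ˢ-trans (reflexive (sym (total-𝒮map a Ψ))) total≈1 , 𝒮≈.≈-refl) ,
      trans (a-mult Ψ) aφ≡t

proposition4p5 : ∀ {c ℓ x p : Level} (S : Semiring c ℓ) (Alg : 𝒮Algebra S x)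
                 (A : 𝒮 S (𝒮Algebra.X Alg) → Set p) →
                 (∀ {φ ψ} → 𝒮≈ S φ ψ → A φ → A ψ) →
                 ∀ (t : 𝒮Algebra.X Alg) →
                 𝒫 (𝒮Algebra.a Alg) (conv S (𝒮≈ S) (μ S) A) t
                   ⇔ conv S _≡_ (𝒮Algebra.a Alg) (𝒫 (𝒮Algebra.a Alg) A) t
proposition4p5 S Alg A _ t =
  mk⇔ (image-conv-μ⊆conv-image S Alg) (conv-image⊆image-conv-μ S Alg)
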